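{- Let $n$, $k$, $t$, $s$ and $h$ be positive integers with $k\geq t+1$ and $n\geq 2k$. Suppose $\mathcal{F}\subseteq \binom{[n]}{k}$ is an $s$-almost $t$-intersecting family and $H\in\binom{[n]}{h}$. If there exists $F\in \mathcal{F}$ such that $|F\cap H|=m<t$, then $$|\mathcal{F}_{H}|\leq (k-t+1)^{t-m}|\mathcal{F}_{R}|+s$$ for some $R\in \binom{[n]}{h+t-m}$ with $H\subseteq R$.
   Context: $\mathcal{F}\subseteq\binom{[n]}{k}$ (the $k$-subsets of $[n]=\{1,\dots,n\}$) is $s$-almost $t$-intersecting if $\left|\{F'\in\mathcal{F}: |F'\cap F|<t\}\right|\leq s$ for every $F\in\mathcal{F}$. For $H\subseteq[n]$, $\mathcal{F}_H=\{F\in\mathcal{F}: H\subseteq F\}$. -}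

module Defs where

open import Data.Nat using (ℕ; _<_; _≤_; _≡ᵇ_)
open import Data.Nat.Properties using (_<?_)
open import Data.Fin.Subset using (Subset; _∩_; ∣_∣)
open import Data.Fin.Subset.Properties using (_⊆?_)
open import Data.List using (List; filter; length)
open import Data.List.Membership.Propositional using (_∈_)
open import Data.List.Relation.Unary.All using (All)
open import Data.List.Relation.Unary.Unique.Propositional using (Unique)
open import Relation.Binary.PropositionalEquality using (_≡_)

-- A family of subsets of [n] = Fin n, given as a duplicate-free list.
Family : ℕ → Set
Family n = List (Subset n)

IsKFamily : {n : ℕ} → ℕ → Family n → Set
IsKFamily k 𝓕 = Unique 𝓕 × All (λ F → ∣ F ∣ ≡ k) 𝓕
  where open import Data.Product using (_×_)

AlmostIntersecting : {n : ℕ} → ℕ → ℕ → Family n → Set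
AlmostIntersecting s t 𝓕 =
  ∀ F → F ∈ 𝓕 → length (filter (λ F' → ∣ F' ∩ F ∣ <? t) 𝓕) ≤ s

_⟨_⟩ : {n : ℕ} → Family n → Subset n → Family n
𝓕 ⟨ H ⟩ = filter (λ F → H ⊆? F) 𝓕

-- Members G of 𝓕 with |G ∩ F| < t number at most s.  Every other member misses
-- at most k − t points of F, so while R ⊇ H meets F in fewer than t points, any
-- k − t + 1 points of F ∖ R meet every such G ⊇ R, and by pigeonhole one of
-- them, x, lies in at least a 1/(k − t + 1) fraction of these G.  Adding such
-- a point to R, t − m times starting from R = H, produces the required R.
module Submission where

open import Defs
open import Data.Bool using (true; false)
open import Data.Nat using (ℕ; zero; suc; _+_; _*_; _∸_; _^_; _≤_; _<_; z≤n; s≤s; s≤s⁻¹; s<s⁻¹)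
open import Data.Nat.Properties
open import Data.Fin using (Fin; zero; suc)
open import Data.Fin.Subset
  using (Subset; _∩_; _∪_; _─_; _-_; ⁅_⁆; _⊆_; ∣_∣; Nonempty; inside; outside)
  renaming (_∈_ to _∈ₛ_; _∉_ to _∉ₛ_)
open import Data.Fin.Subset.Properties
open import Data.List using (List; []; _∷_; filter; length)
open import Data.List.Membership.Propositional using (_∈_)
open import Data.List.Membership.Propositional.Properties using (∈-filter⁻)
open import Data.List.Properties using (filter-≐; filter-all)
open import Data.List.Relation.Binary.Sublist.Propositional.Properties
  using (filter⁺; filter-⊆; length-mono-≤)
import Data.List.Relation.Unary.All as All
open import Data.Product using (∃; Σ; _×_; _,_; proj₁; proj₂; swap)
open import Data.Sum using (_⊎_; inj₁; inj₂; [_,_]′)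
open import Data.Vec using ([]; _∷_; here; there)
open import Function using (id; _∘_)
open import Level using (Level)
open import Relation.Binary.PropositionalEquality
open import Relation.Nullary using (yes; no; does; contradiction)
open import Relation.Unary using (Pred; Decidable)
open import Relation.Unary.Properties using (_∩?_; ∁?)

private
  variable
    ℓ ℓ₁ ℓ₂ : Level
    A : Set ℓ
    P : Pred A ℓ₁
    Q : Pred A ℓ₂
    n : ℕ
    p q : Subset n
    x : Fin n

filter-filter : (P? : Decidable P) (Q? : Decidable Q) (xs : List A) →
  filter P? (filter Q? xs) ≡ filter (P? ∩? Q?) xs
filter-filter P? Q? [] = refl
filter-filter P? Q? (x ∷ xs) with does (Q? x)
... | false with does (P? x)
...   | true  = filter-filter P? Q? xs
...   | false = filter-filter P? Q? xs
filter-filter P? Q? (x ∷ xs) | true with does (P? x)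
...   | true  = cong (x ∷_) (filter-filter P? Q? xs)
...   | false = filter-filter P? Q? xs

filter-comm : (P? : Decidable P) (Q? : Decidable Q) (xs : List A) →
  filter P? (filter Q? xs) ≡ filter Q? (filter P? xs)
filter-comm P? Q? xs = begin
  filter P? (filter Q? xs) ≡⟨ filter-filter P? Q? xs ⟩
  filter (P? ∩? Q?) xs     ≡⟨ filter-≐ (P? ∩? Q?) (Q? ∩? P?) (swap , swap) xs ⟩
  filter (Q? ∩? P?) xs     ≡⟨ filter-filter Q? P? xs ⟨
  filter Q? (filter P? xs) ∎
  where open ≡-Reasoning

length-filter+filter-∁ : (P? : Decidable P) (xs : List A) →
  length (filter P? xs) + length (filter (∁? P?) xs) ≡ length xs
length-filter+filter-∁ P? [] = refl
length-filter+filter-∁ P? (x ∷ xs) with does (P? x)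
... | true  = cong suc (length-filter+filter-∁ P? xs)
... | false = trans (+-suc _ _) (cong suc (length-filter+filter-∁ P? xs))

length-filter∘filter≤ : (P? : Decidable P) (Q? : Decidable Q) (xs : List A) →
  length (filter P? (filter Q? xs)) ≤ length (filter P? xs)
length-filter∘filter≤ P? Q? xs =
  length-mono-≤ (filter⁺ P? P? (λ { refl → id }) (filter-⊆ Q? xs))

∣p∣≡∣p∩q∣+∣p─q∣ : ∀ (p q : Subset n) → ∣ p ∣ ≡ ∣ p ∩ q ∣ + ∣ p ─ q ∣
∣p∣≡∣p∩q∣+∣p─q∣ []            []            = refl
∣p∣≡∣p∩q∣+∣p─q∣ (inside  ∷ p) (inside  ∷ q) = cong suc (∣p∣≡∣p∩q∣+∣p─q∣ p q)
∣p∣≡∣p∩q∣+∣p─q∣ (inside  ∷ p) (outside ∷ q) =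
  trans (cong suc (∣p∣≡∣p∩q∣+∣p─q∣ p q)) (sym (+-suc _ _))
∣p∣≡∣p∩q∣+∣p─q∣ (outside ∷ p) (inside  ∷ q) = ∣p∣≡∣p∩q∣+∣p─q∣ p q
∣p∣≡∣p∩q∣+∣p─q∣ (outside ∷ p) (outside ∷ q) = ∣p∣≡∣p∩q∣+∣p─q∣ p q

∣p─q∣≡∣p∣∸∣p∩q∣ : ∀ (p q : Subset n) → ∣ p ─ q ∣ ≡ ∣ p ∣ ∸ ∣ p ∩ q ∣
∣p─q∣≡∣p∣∸∣p∩q∣ p q = begin
  ∣ p ─ q ∣                           ≡⟨ m+n∸m≡n ∣ p ∩ q ∣ ∣ p ─ q ∣ ⟨
  ∣ p ∩ q ∣ + ∣ p ─ q ∣ ∸ ∣ p ∩ q ∣   ≡⟨ cong (_∸ ∣ p ∩ q ∣) (∣p∣≡∣p∩q∣+∣p─q∣ p q) ⟨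
  ∣ p ∣ ∸ ∣ p ∩ q ∣                   ∎
  where open ≡-Reasoning

∣p─q─r∣≤∣p─r∣ : ∀ (p q r : Subset n) → ∣ p ─ q ─ r ∣ ≤ ∣ p ─ r ∣
∣p─q─r∣≤∣p─r∣ p q r =
  subst (_≤ ∣ p ─ r ∣) (cong ∣_∣ (p─q─r≡p─r─q p r q)) (∣p─q∣≤∣p∣ (p ─ r) q)

x∈p⇒∣p∣≡1+∣p-x∣ : x ∈ₛ p → ∣ p ∣ ≡ suc ∣ p - x ∣
x∈p⇒∣p∣≡1+∣p-x∣ {p = inside  ∷ p} here      = cong (suc ∘ ∣_∣) (sym (p─⊥≡p p))
x∈p⇒∣p∣≡1+∣p-x∣ {p = inside  ∷ p} (there x∈p) = cong suc (x∈p⇒∣p∣≡1+∣p-x∣ x∈p)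
x∈p⇒∣p∣≡1+∣p-x∣ {p = outside ∷ p} (there x∈p) = x∈p⇒∣p∣≡1+∣p-x∣ x∈p

x∉p⇒∣p∪⁅x⁆∣≡1+∣p∣ : x ∉ₛ p → ∣ p ∪ ⁅ x ⁆ ∣ ≡ suc ∣ p ∣
x∉p⇒∣p∪⁅x⁆∣≡1+∣p∣ {x = zero}  {inside  ∷ p} x∉p = contradiction here x∉p
x∉p⇒∣p∪⁅x⁆∣≡1+∣p∣ {x = zero}  {outside ∷ p} x∉p = cong (suc ∘ ∣_∣) (∪-identityʳ p)
x∉p⇒∣p∪⁅x⁆∣≡1+∣p∣ {x = suc x} {inside  ∷ p} x∉p = cong suc (x∉p⇒∣p∪⁅x⁆∣≡1+∣p∣ (x∉p ∘ there))
x∉p⇒∣p∪⁅x⁆∣≡1+∣p∣ {x = suc x} {outside ∷ p} x∉p = x∉p⇒∣p∪⁅x⁆∣≡1+∣p∣ (x∉p ∘ there)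

x∈p─q⇒x∉q : x ∈ₛ p ─ q → x ∉ₛ q
x∈p─q⇒x∉q {p = _ ∷ p} {inside  ∷ q} () here
x∈p─q⇒x∉q {p = _ ∷ p} {_       ∷ q} (there x∈p─q) (there x∈q) = x∈p─q⇒x∉q x∈p─q x∈q

x∈p⇒⁅x⁆⊆p : x ∈ₛ p → ⁅ x ⁆ ⊆ p
x∈p⇒⁅x⁆⊆p {x = x} {p = p} x∈p y∈⁅x⁆ = subst (_∈ₛ p) (sym (x∈⁅y⁆⇒x≡y x y∈⁅x⁆)) x∈p

∣p─q∣≡0⇒p⊆q : ∣ p ─ q ∣ ≡ 0 → p ⊆ q
∣p─q∣≡0⇒p⊆q {p = p} {q = q} ∣p─q∣≡0 {x} x∈p with x ∈? q
... | yes x∈q = x∈q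
... | no  x∉q = contradiction ∣p─q∣≡0
  (>⇒≢ (≤-trans (s≤s z≤n) (x∈p⇒∣p-x∣<∣p∣ (x∈p∧x∉q⇒x∈p─q x∈p x∉q))))

∣p∣>0⇒Nonempty : ∀ {n} {p : Subset n} → 0 < ∣ p ∣ → Nonempty p
∣p∣>0⇒Nonempty {n = n} {p = p} 0<∣p∣ with nonempty? p
... | yes p≢∅ = p≢∅
... | no  p≡∅ = contradiction (trans (cong ∣_∣ (Empty-unique p≡∅)) (∣⊥∣≡0 n)) (>⇒≢ 0<∣p∣)

p⊆r∧q⊆r⇒p∪q⊆r : ∀ {r : Subset n} → p ⊆ r → q ⊆ r → p ∪ q ⊆ r
p⊆r∧q⊆r⇒p∪q⊆r {p = p} {q = q} p⊆r q⊆r x∈p∪q = [ p⊆r , q⊆r ]′ (x∈p∪q⁻ p q x∈p∪q)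

⟨⟩-∪ : ∀ (𝓕 : Family n) R S → 𝓕 ⟨ R ⟩ ⟨ S ⟩ ≡ 𝓕 ⟨ R ∪ S ⟩
⟨⟩-∪ 𝓕 R S = trans (filter-filter (S ⊆?_) (R ⊆?_) 𝓕) (filter-≐ _ (R ∪ S ⊆?_) (to , from) 𝓕)
  where
  to : ∀ {G} → S ⊆ G × R ⊆ G → R ∪ S ⊆ G
  to (S⊆G , R⊆G) = p⊆r∧q⊆r⇒p∪q⊆r R⊆G S⊆G
  from : ∀ {G} → R ∪ S ⊆ G → S ⊆ G × R ⊆ G
  from R∪S⊆G = R∪S⊆G ∘ q⊆p∪q R S , R∪S⊆G ∘ p⊆p∪q S

a+m*b≤[1+m]*a⊎a+m*b≤[1+m]*b : ∀ m a b → a + m * b ≤ suc m * a ⊎ a + m * b ≤ suc m * b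
a+m*b≤[1+m]*a⊎a+m*b≤[1+m]*b m a b with ≤-total a b
... | inj₁ a≤b = inj₂ (+-monoˡ-≤ (m * b) a≤b)
... | inj₂ b≤a = inj₁ (+-monoʳ-≤ a (*-monoʳ-≤ m b≤a))

popular-element : ∀ {n} c (E : Subset n) (𝓛 : Family n) → c < ∣ E ∣ →
  (∀ G → G ∈ 𝓛 → ∣ E ─ G ∣ ≤ c) →
  ∃ λ x → x ∈ₛ E × length 𝓛 ≤ (c + 1) * length (𝓛 ⟨ ⁅ x ⁆ ⟩)
popular-element c E 𝓛 c<∣E∣ misses with ∣p∣>0⇒Nonempty {p = E} (≤-trans (s≤s z≤n) c<∣E∣)
popular-element zero E 𝓛 _ misses | x , x∈E =
  x , x∈E , ≤-reflexive (trans (cong length (sym (filter-all (⁅ x ⁆ ⊆?_) all∋x))) (sym (+-identityʳ _)))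
  where
  all∋x : All.All (⁅ x ⁆ ⊆_) 𝓛
  all∋x = All.tabulate λ {G} G∈𝓛 →
    x∈p⇒⁅x⁆⊆p (∣p─q∣≡0⇒p⊆q (n≤0⇒n≡0 (misses G G∈𝓛)) x∈E)
popular-element {n} (suc c) E 𝓛 c<∣E∣ misses | x , x∈E =
  choose (popular-element c (E - x) 𝓛∌x c<∣E-x∣ misses∌x)
  where
  𝓛∌x : Family n
  𝓛∌x = filter (∁? (⁅ x ⁆ ⊆?_)) 𝓛

  c<∣E-x∣ : c < ∣ E - x ∣
  c<∣E-x∣ = s<s⁻¹ (subst (suc c <_) (x∈p⇒∣p∣≡1+∣p-x∣ x∈E) c<∣E∣)

  misses∌x : ∀ G → G ∈ 𝓛∌x → ∣ E - x ─ G ∣ ≤ c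
  misses∌x G G∈𝓛∌x = s≤s⁻¹ (begin
    suc ∣ E - x ─ G ∣ ≡⟨ cong (suc ∘ ∣_∣) (p─q─r≡p─r─q E ⁅ x ⁆ G) ⟩
    suc ∣ E ─ G - x ∣ ≡⟨ x∈p⇒∣p∣≡1+∣p-x∣ (x∈p∧x∉q⇒x∈p─q x∈E x∉G) ⟨
    ∣ E ─ G ∣         ≤⟨ misses G G∈𝓛 ⟩
    suc c             ∎)
    where
    open ≤-Reasoning
    G∈𝓛 : G ∈ 𝓛
    G∈𝓛 = proj₁ (∈-filter⁻ (∁? (⁅ x ⁆ ⊆?_)) {xs = 𝓛} G∈𝓛∌x)
    x∉G : x ∉ₛ G
    x∉G = proj₂ (∈-filter⁻ (∁? (⁅ x ⁆ ⊆?_)) {xs = 𝓛} G∈𝓛∌x) ∘ x∈p⇒⁅x⁆⊆p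

  choose : (∃ λ y → y ∈ₛ E - x × length 𝓛∌x ≤ (c + 1) * length (𝓛∌x ⟨ ⁅ y ⁆ ⟩)) →
    ∃ λ z → z ∈ₛ E × length 𝓛 ≤ (suc c + 1) * length (𝓛 ⟨ ⁅ z ⁆ ⟩)
  choose (y , y∈E-x , bound) =
    [ (λ ≤[1+m]*a → x , x∈E , ≤-trans split ≤[1+m]*a)
    , (λ ≤[1+m]*b → y , p─q⊆p E ⁅ x ⁆ y∈E-x , ≤-trans split ≤[1+m]*b)
    ]′ (a+m*b≤[1+m]*a⊎a+m*b≤[1+m]*b (c + 1) a b)
    where
    open ≤-Reasoning
    a b : ℕ
    a = length (𝓛 ⟨ ⁅ x ⁆ ⟩)
    b = length (𝓛 ⟨ ⁅ y ⁆ ⟩)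
    split : length 𝓛 ≤ a + (c + 1) * b
    split = begin
      length 𝓛                             ≡⟨ length-filter+filter-∁ (⁅ x ⁆ ⊆?_) 𝓛 ⟨
      a + length 𝓛∌x                       ≤⟨ +-monoʳ-≤ a bound ⟩
      a + (c + 1) * length (𝓛∌x ⟨ ⁅ y ⁆ ⟩) ≤⟨ +-monoʳ-≤ a (*-monoʳ-≤ (c + 1)
                                                (length-filter∘filter≤ (⁅ y ⁆ ⊆?_) _ 𝓛)) ⟩
      a + (c + 1) * b                      ∎

module Growth {n} (F : Subset n) (c : ℕ) (𝓛 : Family n)
              (misses : ∀ G → G ∈ 𝓛 → ∣ F ─ G ∣ ≤ c) where

  extend : ∀ d R → ∣ F ─ R ∣ ≡ suc d + c →
    ∃ λ x → x ∉ₛ R × ∣ F ─ (R ∪ ⁅ x ⁆) ∣ ≡ d + c ×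
            length (𝓛 ⟨ R ⟩) ≤ (c + 1) * length (𝓛 ⟨ R ∪ ⁅ x ⁆ ⟩)
  extend d R ∣F─R∣≡1+d+c
    with popular-element c (F ─ R) (𝓛 ⟨ R ⟩)
           (subst (c <_) (sym ∣F─R∣≡1+d+c) (s≤s (m≤n+m c d)))
           (λ G G∈𝓛⟨R⟩ → ≤-trans (∣p─q─r∣≤∣p─r∣ F R G)
                                  (misses G (proj₁ (∈-filter⁻ (R ⊆?_) {xs = 𝓛} G∈𝓛⟨R⟩))))
  ... | x , x∈F─R , bound =
    x , x∈p─q⇒x∉q x∈F─R , suc-injective ∣F─R∪x∣≡1+d+c ,
    subst (λ 𝓜 → length (𝓛 ⟨ R ⟩) ≤ (c + 1) * length 𝓜) (⟨⟩-∪ 𝓛 R ⁅ x ⁆) bound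
    where
    ∣F─R∪x∣≡1+d+c : suc ∣ F ─ (R ∪ ⁅ x ⁆) ∣ ≡ suc (d + c)
    ∣F─R∪x∣≡1+d+c = begin
      suc ∣ F ─ (R ∪ ⁅ x ⁆) ∣ ≡⟨ cong (suc ∘ ∣_∣) (p─q─r≡p─q∪r F R ⁅ x ⁆) ⟨
      suc ∣ F ─ R - x ∣       ≡⟨ x∈p⇒∣p∣≡1+∣p-x∣ x∈F─R ⟨
      ∣ F ─ R ∣               ≡⟨ ∣F─R∣≡1+d+c ⟩
      suc (d + c)             ∎
      where open ≡-Reasoning

  grow : ∀ d R → ∣ F ─ R ∣ ≡ d + c →
    ∃ λ R' → ∣ R' ∣ ≡ ∣ R ∣ + d × R ⊆ R' ×
             length (𝓛 ⟨ R ⟩) ≤ (c + 1) ^ d * length (𝓛 ⟨ R' ⟩)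
  grow zero    R _ = R , sym (+-identityʳ _) , id , ≤-reflexive (sym (*-identityˡ _))
  grow (suc d) R ∣F─R∣≡1+d+c with extend d R ∣F─R∣≡1+d+c
  ... | x , x∉R , ∣F─R∪x∣≡d+c , bound₁ with grow d (R ∪ ⁅ x ⁆) ∣F─R∪x∣≡d+c
  ... | R' , ∣R'∣≡ , R∪x⊆R' , bound₂ = R' , ∣R'∣≡∣R∣+1+d , R∪x⊆R' ∘ p⊆p∪q ⁅ x ⁆ , bound
    where
    ∣R'∣≡∣R∣+1+d : ∣ R' ∣ ≡ ∣ R ∣ + suc d
    ∣R'∣≡∣R∣+1+d = begin
      ∣ R' ∣            ≡⟨ ∣R'∣≡ ⟩
      ∣ R ∪ ⁅ x ⁆ ∣ + d ≡⟨ cong (_+ d) (x∉p⇒∣p∪⁅x⁆∣≡1+∣p∣ x∉R) ⟩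
      suc ∣ R ∣ + d     ≡⟨ +-suc ∣ R ∣ d ⟨
      ∣ R ∣ + suc d     ∎
      where open ≡-Reasoning
    bound : length (𝓛 ⟨ R ⟩) ≤ (c + 1) ^ suc d * length (𝓛 ⟨ R' ⟩)
    bound = begin
      length (𝓛 ⟨ R ⟩)                            ≤⟨ bound₁ ⟩
      (c + 1) * length (𝓛 ⟨ R ∪ ⁅ x ⁆ ⟩)          ≤⟨ *-monoʳ-≤ (c + 1) bound₂ ⟩
      (c + 1) * ((c + 1) ^ d * length (𝓛 ⟨ R' ⟩)) ≡⟨ *-assoc (c + 1) _ _ ⟨
      (c + 1) ^ suc d * length (𝓛 ⟨ R' ⟩)         ∎
      where open ≤-Reasoning

superset-bound : ∀ {n} k t m (F H : Subset n) (𝓖 : Family n) →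
  ∣ F ∣ ≡ k → ∣ F ∩ H ∣ ≡ m → m ≤ t → t ≤ k →
  (∀ G → G ∈ 𝓖 → t ≤ ∣ G ∩ F ∣) →
  ∃ λ R → ∣ R ∣ ≡ ∣ H ∣ + (t ∸ m) × H ⊆ R ×
          length (𝓖 ⟨ H ⟩) ≤ (k ∸ t + 1) ^ (t ∸ m) * length (𝓖 ⟨ R ⟩)
superset-bound k t m F H 𝓖 ∣F∣≡k ∣F∩H∣≡m m≤t t≤k t≤∣G∩F∣ = grow (t ∸ m) H ∣F─H∣≡t∸m+[k∸t]
  where
  misses : ∀ G → G ∈ 𝓖 → ∣ F ─ G ∣ ≤ k ∸ t
  misses G G∈𝓖 = begin
    ∣ F ─ G ∣         ≡⟨ ∣p─q∣≡∣p∣∸∣p∩q∣ F G ⟩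
    ∣ F ∣ ∸ ∣ F ∩ G ∣ ≡⟨ cong₂ _∸_ ∣F∣≡k (cong ∣_∣ (∩-comm F G)) ⟩
    k ∸ ∣ G ∩ F ∣     ≤⟨ ∸-monoʳ-≤ k (t≤∣G∩F∣ G G∈𝓖) ⟩
    k ∸ t             ∎
    where open ≤-Reasoning
  open Growth F (k ∸ t) 𝓖 misses
  ∣F─H∣≡t∸m+[k∸t] : ∣ F ─ H ∣ ≡ t ∸ m + (k ∸ t)
  ∣F─H∣≡t∸m+[k∸t] = begin
    ∣ F ─ H ∣         ≡⟨ ∣p─q∣≡∣p∣∸∣p∩q∣ F H ⟩
    ∣ F ∣ ∸ ∣ F ∩ H ∣ ≡⟨ cong₂ _∸_ ∣F∣≡k ∣F∩H∣≡m ⟩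
    k ∸ m             ≡⟨ cong (_∸ m) (m∸n+n≡m t≤k) ⟨
    k ∸ t + t ∸ m     ≡⟨ +-∸-assoc (k ∸ t) m≤t ⟩
    k ∸ t + (t ∸ m)   ≡⟨ +-comm (k ∸ t) (t ∸ m) ⟩
    t ∸ m + (k ∸ t)   ∎
    where open ≡-Reasoning

meeting : Subset n → ℕ → Family n → Family n
meeting F t 𝓕 = filter (∁? (λ G → ∣ G ∩ F ∣ <? t)) 𝓕

∈-meeting⁻ : ∀ {F G : Subset n} {t} (𝓕 : Family n) → G ∈ meeting F t 𝓕 → t ≤ ∣ G ∩ F ∣
∈-meeting⁻ {F = F} {t = t} 𝓕 G∈ = ≮⇒≥ (proj₂ (∈-filter⁻ (∁? (λ G → ∣ G ∩ F ∣ <? t)) {xs = 𝓕} G∈))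

∣𝓕⟨R⟩∣≤s+∣meeting⟨R⟩∣ : ∀ {s t} {F : Subset n} {𝓕 : Family n} →
  AlmostIntersecting s t 𝓕 → F ∈ 𝓕 → ∀ R → length (𝓕 ⟨ R ⟩) ≤ s + length (meeting F t 𝓕 ⟨ R ⟩)
∣𝓕⟨R⟩∣≤s+∣meeting⟨R⟩∣ {s = s} {t} {F} {𝓕} almost F∈𝓕 R = begin
  length (𝓕 ⟨ R ⟩)
    ≡⟨ length-filter+filter-∁ short? (𝓕 ⟨ R ⟩) ⟨
  length (filter short? (𝓕 ⟨ R ⟩)) + length (filter (∁? short?) (𝓕 ⟨ R ⟩))
    ≤⟨ +-monoˡ-≤ _ (length-filter∘filter≤ short? (R ⊆?_) 𝓕) ⟩
  length (filter short? 𝓕) + length (filter (∁? short?) (𝓕 ⟨ R ⟩))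
    ≤⟨ +-monoˡ-≤ _ (almost F F∈𝓕) ⟩
  s + length (filter (∁? short?) (𝓕 ⟨ R ⟩))
    ≡⟨ cong (λ 𝓜 → s + length 𝓜) (filter-comm (∁? short?) (R ⊆?_) 𝓕) ⟩
  s + length (meeting F t 𝓕 ⟨ R ⟩)
    ∎
  where
  open ≤-Reasoning
  short? : Decidable (λ G → ∣ G ∩ F ∣ < t)
  short? G = ∣ G ∩ F ∣ <? t

lemma3p1 : (n k t s h : ℕ) → 1 ≤ n → 1 ≤ k → 1 ≤ t → 1 ≤ s → 1 ≤ h →
    t + 1 ≤ k → 2 * k ≤ n →
    (𝓕 : Family n) → IsKFamily k 𝓕 → AlmostIntersecting s t 𝓕 →
    (H : Subset n) → ∣ H ∣ ≡ h →
    (m : ℕ) → (F : Subset n) → F ∈ 𝓕 → ∣ F ∩ H ∣ ≡ m → m < t →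
    Σ (Subset n) (λ R → ∣ R ∣ ≡ h + t ∸ m × H ⊆ R ×
      length (𝓕 ⟨ H ⟩) ≤ (k ∸ t + 1) ^ (t ∸ m) * length (𝓕 ⟨ R ⟩) + s)
lemma3p1 n k t s h _ _ _ _ _ t+1≤k _ 𝓕 (_ , ∣𝓕∣≡k) almost H ∣H∣≡h m F F∈𝓕 ∣F∩H∣≡m m<t
  with superset-bound k t m F H (meeting F t 𝓕) (All.lookup ∣𝓕∣≡k F∈𝓕) ∣F∩H∣≡m (<⇒≤ m<t)
         (≤-trans (m≤m+n t 1) t+1≤k) (λ _ → ∈-meeting⁻ 𝓕)
... | R , ∣R∣≡∣H∣+[t∸m] , H⊆R , bound = R , ∣R∣≡h+t∸m , H⊆R , (begin
  length (𝓕 ⟨ H ⟩)                     ≤⟨ ∣𝓕⟨R⟩∣≤s+∣meeting⟨R⟩∣ almost F∈𝓕 H ⟩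
  s + length (meeting F t 𝓕 ⟨ H ⟩)     ≤⟨ +-monoʳ-≤ s bound ⟩
  s + X * length (meeting F t 𝓕 ⟨ R ⟩) ≤⟨ +-monoʳ-≤ s (*-monoʳ-≤ X (length-filter∘filter≤ (R ⊆?_) _ 𝓕)) ⟩
  s + X * length (𝓕 ⟨ R ⟩)             ≡⟨ +-comm s _ ⟩
  X * length (𝓕 ⟨ R ⟩) + s             ∎)
  where
  open ≤-Reasoning
  X : ℕ
  X = (k ∸ t + 1) ^ (t ∸ m)
  ∣R∣≡h+t∸m : ∣ R ∣ ≡ h + t ∸ m
  ∣R∣≡h+t∸m = trans ∣R∣≡∣H∣+[t∸m] (trans (cong (_+ (t ∸ m)) ∣H∣≡h) (sym (+-∸-assoc h (<⇒≤ m<t))))
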